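{- Fix constants $m,m_1,m_2\in\mathbb{Z}_{\ge0}$ with $m=m_1+m_2$, and let $\sigma\in\{1,2\}$. Let $v\in[n]$ and $W\subseteq[v-1]$, and let $E$ be any event that involves only edges stemming from vertices in $[v-1]$ in the process leading to $G^n_{m_1,m_2}$. Then, conditional upon $E$, the probability that $\pi_\sigma(G^n_{m_1,m_2})$ has no edges between $v$ and $W$ is at most \[\left(1-\frac{|W|}{2v}\right)^{m_\sigma}.\]
   Context: Preferential attachment model: let $G_1^1$ be the graph with one vertex $1$ and one loop. Given $G_1^{t-1}$, form $G_1^t$ by adding vertex $t$ with one edge between $t$ and a random vertex $i$, where $\Pr(i=s)=\deg(s,t-1)/(2t-1)$ for $1\le s\le t-1$ and $\Pr(i=t)=1/(2t-1)$, $\deg(s,t-1)$ being the degree of $s$ in $G_1^{t-1}$ (a loop contributes $2$). For $m\ge1$, $G_m^n$ is obtained from $G_1^{mn}$ on vertices $1',\dots,(mn)'$ by identifying $(m(i-1)+1)',\dots,(mi)'$ into vertex $i$; equivalently, each new vertex $t$ adds $m$ edges one at a time, each joined to a vertex chosen with probability proportional to current degrees (counting all previous edges, and the new edge as contributing one to the degree of $t$). $G^n_0$ is the edgeless graph on $[n]$. An edge $vw$ with $w\le v$ stems from $v$. Given $m=m_1+m_2$, $G^n_{m_1,m_2}$ is $G^n_m$ in which, for each vertex $v$, the first $m_1$ edges stemming from $v$ are coloured blue and the remaining $m_2$ red; $\pi_1(G^n_{m_1,m_2})$ (resp.\ $\pi_2(G^n_{m_1,m_2})$) is the graph on $[n]$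 consisting of the blue (resp.\ red) edges. -}

module Defs where

open import Data.Nat using (ℕ; zero; suc; _+_; _*_; _∸_; _≡ᵇ_; _<ᵇ_)
open import Data.Product using (_×_; _,_)
open import Data.Nat.DivMod using (_/_; _%_)
open import Data.Bool using (Bool; true; false; if_then_else_; _∧_; _∨_; not)
open import Data.List using (List; []; _∷_; _++_; [_]; map; concatMap; upTo; length; zip)
open import Data.Nat.ListAction using (sum)
open import Data.Bool.ListAction using (any)

-- A run of the process G_1^1, G_1^2, ..., G_1^N is recorded as the list
-- of choices  c_1 , ... , c_N  where at step t vertex t is joined to c_t ∈ [1..t]
-- (c_1 = 1 is the initial loop).  Vertices of G_1^N are 1..N.

ind : Bool → ℕ
ind true  = 1
ind false = 0

degAux : ℕ → List ℕ → ℕ → ℕ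
degAux k []       s = 0
degAux k (c ∷ cs) s = ind (k ≡ᵇ s) + ind (c ≡ᵇ s) + degAux (suc k) cs s

-- deg(s, t-1) in G_1^{t-1}, given the choices c_1..c_{t-1} (a loop counts 2)
deg : List ℕ → ℕ → ℕ
deg cs s = degAux 1 cs s

-- numerator of Pr(c_t = i) given prefix c_1..c_{t-1}; the denominator is 2t-1
choiceWeight : List ℕ → ℕ → ℕ
choiceWeight prefix i =
  if i ≡ᵇ suc (length prefix) then 1 else deg prefix i

weightAux : List ℕ → List ℕ → ℕ
weightAux p []         = 1
weightAux p (i ∷ rest) = choiceWeight p i * weightAux (p ++ [ i ]) rest

-- Pr(run = cs) * ∏_{t=1}^{N} (2t-1)   (common denominator for all runs of length N)
weight : List ℕ → ℕ
weight cs = weightAux [] cs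

outcomes : ℕ → List (List ℕ)
outcomes zero    = [] ∷ []
outcomes (suc N) =
  concatMap (λ c → map (λ i → c ++ [ i ]) (map suc (upTo (suc N)))) (outcomes N)

-- weighted count: Pr(P) * ∏_{t=1}^{N} (2t-1)  for runs of length N
mass : (List ℕ → Bool) → List (List ℕ) → ℕ
mass P outs = sum (map (λ c → if P c then weight c else 0) outs)

-- vertex i of G_m^n containing vertex t of G_1^{mn}: ceil(t/m)  (m ≥ 1)
proj : ℕ → ℕ → ℕ
proj zero    t = 0
proj (suc k) t = suc ((t ∸ 1) / suc k)

-- the two colours (σ = 1 blue, σ = 2 red)
data Colour : Set where
  blue red : Colour

_≟ᶜ_ : Colour → Colour → Bool
blue ≟ᶜ blue = true
red  ≟ᶜ red  = true
_    ≟ᶜ _    = false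

mOf : ℕ → ℕ → Colour → ℕ
mOf m₁ m₂ blue = m₁
mOf m₁ m₂ red  = m₂

-- colour of the edge added at step t of G_1^{m n}: it is edge number
-- (t-1) mod m (0-based) among the m edges stemming from vertex proj m t
colourOf : ℕ → ℕ → ℕ → Colour
colourOf m₁ zero    t = blue
colourOf m₁ (suc k) t = if ((t ∸ 1) % suc k) <ᵇ m₁ then blue else red

steps : List ℕ → List (ℕ × ℕ)
steps cs = zip (map suc (upTo (length cs))) cs

memb : ℕ → List ℕ → Bool
memb x W = any (λ w → x ≡ᵇ w) W

joins : ℕ → List ℕ → ℕ → ℕ → Bool
joins v W a b = ((a ≡ᵇ v) ∧ memb b W) ∨ ((b ≡ᵇ v) ∧ memb a W)

-- π_σ(G^n_{m₁,m₂}) (built from the run cs of G_1^{mn}, m = m₁ + m₂)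
-- has an edge between v and W
hasEdgeTo : ℕ → ℕ → Colour → ℕ → List ℕ → List ℕ → Bool
hasEdgeTo m₁ m₂ σ v W cs =
  any (λ { (t , c) → (colourOf m₁ (m₁ + m₂) t ≟ᶜ σ)
                     ∧ joins v W (proj (m₁ + m₂) t) (proj (m₁ + m₂) c) })
      (steps cs)

module Submission where

-- Reveal the process one step of G₁ at a time and compare, after k steps, the
-- weighted masses X_k of "E and no σ-edge between v and W" and Y_k of "E".
-- Since E only sees the first m(v − 1) steps, every later step multiplies Y_k
-- by the total weight 2k + 1 of its choices and X_k by at most that.  At each of
-- the m_σ steps adding a σ-coloured edge stemming from v, the vertices of W have
-- total weight at least m|W| (each of their m G₁-vertices has degree ≥ 1) out of
-- 2k + 1 ≤ 2mv, so X_k gains at most the factor (2v − |W|)(2k + 1)/2v.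

open import Defs
open import Data.Nat using (ℕ; zero; suc; _+_; _*_; _∸_; _^_; _≤_; _<_; z≤n; s≤s; _≡ᵇ_; _<ᵇ_; NonZero)
open import Data.Nat.Properties
open import Data.Nat.DivMod
  using (_/_; _%_; /-congˡ; %-congˡ; +-distrib-/-∣ʳ; m<n⇒m/n≡0; m*n/n≡m; [m+kn]%n≡m%n; m<n⇒m%n≡m)
open import Data.Nat.Divisibility using (n∣m*n)
open import Data.Nat.ListAction using (sum)
open import Data.Nat.ListAction.Properties using (sum-++)
open import Data.Nat.Tactic.RingSolver using (solve-∀)
open import Data.Bool using (Bool; true; false; _∧_; _∨_; not; if_then_else_; T)
open import Data.Bool.Properties using (∨-assoc; ∨-identityʳ; ∧-zeroʳ)
open import Data.Bool.ListAction using (any)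
open import Data.Product using (_×_; _,_)
open import Data.Sum using (inj₁; inj₂)
open import Data.List using (List; []; _∷_; _++_; [_]; _∷ʳ_; map; concatMap; upTo; applyUpTo; length; zip; take)
open import Data.List.Properties
  using (map-++; map-cong; map-applyUpTo; ++-identityʳ; ++-assoc; length-++; length-map; length-upTo; upTo-∷ʳ)
open import Data.List.Relation.Unary.All using (All; []; _∷_) renaming (map to All-map)
import Data.List.Relation.Unary.All.Properties as All
open import Data.List.Relation.Unary.Unique.Propositional using (Unique)
open import Data.List.Relation.Unary.AllPairs using ([]; _∷_)
open import Data.Empty using (⊥-elim)
open import Data.Unit using (tt)
open import Function using (_∘_; id)
open import Relation.Binary.PropositionalEquality hiding ([_])
import Algebra.Properties.CommutativeSemigroup as CommutativeSemigroupProperties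

module +-CS = CommutativeSemigroupProperties +-commutativeSemigroup
module *-CS = CommutativeSemigroupProperties *-commutativeSemigroup

sumBelow : ℕ → (ℕ → ℕ) → ℕ
sumBelow zero    f = 0
sumBelow (suc n) f = f 0 + sumBelow n (f ∘ suc)

infix 5 sumBelow
syntax sumBelow n (λ i → e) = ∑[ i < n ] e

∑-cong : ∀ n {f g} → (∀ i → i < n → f i ≡ g i) → sumBelow n f ≡ sumBelow n g
∑-cong zero    _ = refl
∑-cong (suc n) e = cong₂ _+_ (e 0 (s≤s z≤n)) (∑-cong n (λ i i<n → e (suc i) (s≤s i<n)))

∑-mono-≤ : ∀ n {f g} → (∀ i → i < n → f i ≤ g i) → sumBelow n f ≤ sumBelow n g
∑-mono-≤ zero    _ = z≤n
∑-mono-≤ (suc n) e = +-mono-≤ (e 0 (s≤s z≤n)) (∑-mono-≤ n (λ i i<n → e (suc i) (s≤s i<n)))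

∑-const : ∀ n c → ∑[ _ < n ] c ≡ n * c
∑-const zero    c = refl
∑-const (suc n) c = cong (c +_) (∑-const n c)

∑-zero : ∀ n {f} → (∀ i → i < n → f i ≡ 0) → sumBelow n f ≡ 0
∑-zero n e = trans (∑-cong n e) (trans (∑-const n 0) (*-zeroʳ n))

∑-distrib-+ : ∀ n f g → ∑[ i < n ] (f i + g i) ≡ sumBelow n f + sumBelow n g
∑-distrib-+ zero    f g = refl
∑-distrib-+ (suc n) f g =
  trans (cong (f 0 + g 0 +_) (∑-distrib-+ n (f ∘ suc) (g ∘ suc)))
        (+-CS.interchange (f 0) (g 0) _ _)

∑-*ˡ : ∀ n k f → ∑[ i < n ] (k * f i) ≡ k * sumBelow n f
∑-*ˡ zero    k f = sym (*-zeroʳ k)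
∑-*ˡ (suc n) k f =
  trans (cong (k * f 0 +_) (∑-*ˡ n k (f ∘ suc))) (sym (*-distribˡ-+ k (f 0) _))

∑-split : ∀ p q f → sumBelow (p + q) f ≡ sumBelow p f + (∑[ i < q ] f (p + i))
∑-split zero    q f = refl
∑-split (suc p) q f = trans (cong (f 0 +_) (∑-split p q (f ∘ suc))) (sym (+-assoc (f 0) _ _))

∑-last : ∀ n f → sumBelow (suc n) f ≡ sumBelow n f + f n
∑-last n f = begin
  sumBelow (suc n) f                 ≡⟨ cong (λ l → sumBelow l f) (+-comm 1 n) ⟩
  sumBelow (n + 1) f                 ≡⟨ ∑-split n 1 f ⟩
  sumBelow n f + (f (n + 0) + 0)     ≡⟨ cong (sumBelow n f +_) (trans (+-identityʳ _) (cong f (+-identityʳ n))) ⟩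
  sumBelow n f + f n                 ∎
  where open ≡-Reasoning

∑-prefix-≤ : ∀ {p n} f → p ≤ n → sumBelow p f ≤ sumBelow n f
∑-prefix-≤ {p} f p≤n with m≤n⇒∃[o]m+o≡n p≤n
... | o , refl = ≤-trans (m≤m+n _ _) (≤-reflexive (sym (∑-split p o f)))

sum-applyUpTo : ∀ n f → sum (applyUpTo f n) ≡ sumBelow n f
sum-applyUpTo zero    f = refl
sum-applyUpTo (suc n) f = cong (f 0 +_) (sum-applyUpTo n (f ∘ suc))

sum-map-++ : ∀ {A : Set} (f : A → ℕ) xs ys → sum (map f (xs ++ ys)) ≡ sum (map f xs) + sum (map f ys)
sum-map-++ f xs ys = trans (cong sum (map-++ f xs ys)) (sum-++ (map f xs) (map f ys))

sum-map-concatMap : ∀ {A B : Set} (f : B → ℕ) (h : A → List B) xs →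
  sum (map f (concatMap h xs)) ≡ sum (map (λ x → sum (map f (h x))) xs)
sum-map-concatMap f h []       = refl
sum-map-concatMap f h (x ∷ xs) =
  trans (sum-map-++ f (h x) (concatMap h xs)) (cong (sum (map f (h x)) +_) (sum-map-concatMap f h xs))

sum-map-cong : ∀ {A : Set} {f g : A → ℕ} {xs} → All (λ x → f x ≡ g x) xs →
  sum (map f xs) ≡ sum (map g xs)
sum-map-cong []       = refl
sum-map-cong (p ∷ ps) = cong₂ _+_ p (sum-map-cong ps)

sum-map-mono-≤ : ∀ {A : Set} {f g : A → ℕ} {xs} → All (λ x → f x ≤ g x) xs →
  sum (map f xs) ≤ sum (map g xs)
sum-map-mono-≤ []       = z≤n
sum-map-mono-≤ (p ∷ ps) = +-mono-≤ p (sum-map-mono-≤ ps)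

sum-map-*ˡ : ∀ {A : Set} k (f : A → ℕ) xs → sum (map (λ x → k * f x) xs) ≡ k * sum (map f xs)
sum-map-*ˡ k f []       = sym (*-zeroʳ k)
sum-map-*ˡ k f (x ∷ xs) = trans (cong (k * f x +_) (sum-map-*ˡ k f xs)) (sym (*-distribˡ-+ k (f x) _))

≡ᵇ-refl : ∀ n → (n ≡ᵇ n) ≡ true
≡ᵇ-refl zero    = refl
≡ᵇ-refl (suc n) = ≡ᵇ-refl n

≡ᵇ-comm : ∀ m n → (m ≡ᵇ n) ≡ (n ≡ᵇ m)
≡ᵇ-comm zero    zero    = refl
≡ᵇ-comm zero    (suc n) = refl
≡ᵇ-comm (suc m) zero    = refl
≡ᵇ-comm (suc m) (suc n) = ≡ᵇ-comm m n

≢⇒≡ᵇ-false : ∀ {m n} → m ≢ n → (m ≡ᵇ n) ≡ false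
≢⇒≡ᵇ-false {m} {n} m≢n with m ≡ᵇ n in eq
... | true  = ⊥-elim (m≢n (≡ᵇ⇒≡ m n (subst T (sym eq) tt)))
... | false = refl

∑-ind-≡ᵇ : ∀ {w L} → 1 ≤ w → w ≤ L → ∑[ i < L ] ind (suc i ≡ᵇ w) ≡ 1
∑-ind-≡ᵇ {suc zero}    {suc L} _ _         = cong suc (∑-zero L (λ _ _ → refl))
∑-ind-≡ᵇ {suc (suc w)} {suc L} _ (s≤s w≤L) = ∑-ind-≡ᵇ {suc w} (s≤s z≤n) w≤L

ind≤1 : ∀ b → ind b ≤ 1
ind≤1 false = z≤n
ind≤1 true  = ≤-refl

ind-∧-≤ : ∀ b x → ind (b ∧ x) ≤ ind b
ind-∧-≤ false x = z≤n
ind-∧-≤ true  x = ind≤1 x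

ind-∧-not-∨ : ∀ b h e → ind (b ∧ not (h ∨ e)) ≡ ind (b ∧ not h) * ind (not e)
ind-∧-not-∨ false h     e     = refl
ind-∧-not-∨ true  true  e     = refl
ind-∧-not-∨ true  false true  = refl
ind-∧-not-∨ true  false false = refl

*-ind-not+*-ind : ∀ c b → c * ind (not b) + c * ind b ≡ c
*-ind-not+*-ind c false = trans (cong₂ _+_ (*-identityʳ c) (*-zeroʳ c)) (+-identityʳ c)
*-ind-not+*-ind c true  = cong₂ _+_ (*-zeroʳ c) (*-identityʳ c)

ind≤*-ind : ∀ c b → 1 ≤ c → ind b ≤ c * ind b
ind≤*-ind c b 1≤c = subst (_≤ c * ind b) (*-identityˡ (ind b)) (*-monoˡ-≤ (ind b) 1≤c)

if-then-0≡*-ind : ∀ b w → (if b then w else 0) ≡ w * ind b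
if-then-0≡*-ind true  w = sym (*-identityʳ w)
if-then-0≡*-ind false w = sym (*-zeroʳ w)

memb-false : ∀ {w} W → All (w ≢_) W → memb w W ≡ false
memb-false []      []       = refl
memb-false (y ∷ W) (p ∷ ps) rewrite ≢⇒≡ᵇ-false p = memb-false W ps

∑-ind-memb : ∀ u W → Unique W → All (λ w → 1 ≤ w × w < suc u) W →
  ∑[ q < u ] ind (memb (suc q) W) ≡ length W
∑-ind-memb u []      _          _                 = ∑-zero u (λ _ _ → refl)
∑-ind-memb u (w ∷ W) (w∉ ∷ uq) ((1≤w , w≤u) ∷ rng) =
  trans (∑-cong u (λ q _ → ind-memb-∷ q))
  (trans (∑-distrib-+ u _ _) (cong₂ _+_ (∑-ind-≡ᵇ 1≤w (≤-pred w≤u)) (∑-ind-memb u W uq rng)))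
  where
  ind-memb-∷ : ∀ q → ind (memb (suc q) (w ∷ W)) ≡ ind (suc q ≡ᵇ w) + ind (memb (suc q) W)
  ind-memb-∷ q with suc q ≡ᵇ w in eq
  ... | false = refl
  ... | true rewrite ≡ᵇ⇒≡ (suc q) w (subst T (sym eq) tt) | memb-false W w∉ = refl

weightAux-∷ʳ : ∀ p cs i → weightAux p (cs ∷ʳ i) ≡ weightAux p cs * choiceWeight (p ++ cs) i
weightAux-∷ʳ p []       i rewrite ++-identityʳ p = *-comm (choiceWeight p i) 1
weightAux-∷ʳ p (c ∷ cs) i rewrite weightAux-∷ʳ (p ∷ʳ c) cs i | ++-assoc p [ c ] cs =
  sym (*-assoc (choiceWeight p c) _ _)

choiceWeight-new : ∀ c → choiceWeight c (suc (length c)) ≡ 1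
choiceWeight-new c rewrite ≡ᵇ-refl (length c) = refl

choiceWeight-old : ∀ c {i} → i < length c → choiceWeight c (suc i) ≡ deg c (suc i)
choiceWeight-old c i<len rewrite ≢⇒≡ᵇ-false (<⇒≢ i<len) = refl

degAux-pos : ∀ k cs {s} → k ≤ s → s < k + length cs → 1 ≤ degAux k cs s
degAux-pos k []       k≤s s<k+0 = ⊥-elim (<⇒≱ s<k+0 (≤-trans (≤-reflexive (+-identityʳ k)) k≤s))
degAux-pos k (c ∷ cs) {s} k≤s s<k+ with m≤n⇒m<n∨m≡n k≤s
... | inj₂ refl rewrite ≡ᵇ-refl k = s≤s z≤n
... | inj₁ k<s  = ≤-trans (degAux-pos (suc k) cs k<s (subst (s <_) (+-suc k (length cs)) s<k+))
                          (m≤n+m _ _)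

-- Handshake lemma: each step adds the new vertex and its chosen endpoint.
∑-degAux : ∀ k cs L → 1 ≤ k → k + length cs ≤ suc L → All (λ x → 1 ≤ x × x ≤ L) cs →
  ∑[ i < L ] degAux k cs (suc i) ≡ length cs + length cs
∑-degAux k []       L _   _        _                   = ∑-zero L (λ _ _ → refl)
∑-degAux k (c ∷ cs) L 1≤k k+cs≤1+L ((1≤c , c≤L) ∷ cs≤L) = begin
  ∑[ i < L ] (ind (k ≡ᵇ suc i) + ind (c ≡ᵇ suc i) + degAux (suc k) cs (suc i))
    ≡⟨ ∑-distrib-+ L _ _ ⟩
  (∑[ i < L ] (ind (k ≡ᵇ suc i) + ind (c ≡ᵇ suc i))) + (∑[ i < L ] degAux (suc k) cs (suc i))
    ≡⟨ cong₂ _+_ (∑-distrib-+ L _ _) (∑-degAux (suc k) cs L (s≤s z≤n) k+cs<1+L cs≤L) ⟩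
  (∑[ i < L ] ind (k ≡ᵇ suc i)) + (∑[ i < L ] ind (c ≡ᵇ suc i)) + (length cs + length cs)
    ≡⟨ cong (_+ (length cs + length cs)) (cong₂ _+_ (once k 1≤k k≤L) (once c 1≤c c≤L)) ⟩
  2 + (length cs + length cs)
    ≡⟨ cong suc (sym (+-suc (length cs) (length cs))) ⟩
  suc (length cs) + suc (length cs) ∎
  where
  open ≡-Reasoning
  k+cs<1+L : suc (k + length cs) ≤ suc L
  k+cs<1+L = subst (_≤ suc L) (+-suc k (length cs)) k+cs≤1+L
  k≤L : k ≤ L
  k≤L = ≤-trans (m≤m+n k (length cs)) (≤-pred k+cs<1+L)
  once : ∀ w → 1 ≤ w → w ≤ L → ∑[ i < L ] ind (w ≡ᵇ suc i) ≡ 1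
  once w 1≤w w≤L = trans (∑-cong L (λ i _ → cong ind (≡ᵇ-comm w (suc i)))) (∑-ind-≡ᵇ 1≤w w≤L)

Bounded : ℕ → List ℕ → Set
Bounded N c = length c ≡ N × All (λ x → 1 ≤ x × x ≤ N) c

∑-choiceWeight : ∀ {N c} → Bounded N c → ∑[ i < suc N ] choiceWeight c (suc i) ≡ suc (N + N)
∑-choiceWeight {N} {c} (refl , c≤N) = begin
  ∑[ i < suc N ] choiceWeight c (suc i)
    ≡⟨ ∑-last N _ ⟩
  (∑[ i < N ] choiceWeight c (suc i)) + choiceWeight c (suc N)
    ≡⟨ cong₂ _+_ (∑-cong N (λ i i<N → choiceWeight-old c i<N)) (choiceWeight-new c) ⟩
  (∑[ i < N ] deg c (suc i)) + 1
    ≡⟨ cong (_+ 1) (∑-degAux 1 c N ≤-refl ≤-refl c≤N) ⟩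
  N + N + 1
    ≡⟨ +-comm (N + N) 1 ⟩
  suc (N + N) ∎
  where open ≡-Reasoning

choiceWeight-pos : ∀ {N c i} → Bounded N c → i < suc N → 1 ≤ choiceWeight c (suc i)
choiceWeight-pos {c = c} (refl , _) (s≤s i≤N) with m≤n⇒m<n∨m≡n i≤N
... | inj₁ i<N  = subst (1 ≤_) (sym (choiceWeight-old c i<N)) (degAux-pos 1 c (s≤s z≤n) (s≤s i<N))
... | inj₂ refl = ≤-reflexive (sym (choiceWeight-new c))

outcomes-bounded : ∀ N → All (Bounded N) (outcomes N)
outcomes-bounded zero    = (refl , []) ∷ []
outcomes-bounded (suc N) = All.concat⁺ (All.map⁺ (All-map extend (outcomes-bounded N)))
  where
  extend : ∀ {c} → Bounded N c → All (Bounded (suc N)) (map (c ∷ʳ_) (map suc (upTo (suc N))))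
  extend {c} (len , c≤N) = All.map⁺ (All.map⁺ (All.applyUpTo⁺₁ id (suc N) λ {i} i<1+N →
    trans (length-++ c) (trans (+-comm (length c) 1) (cong suc len)) ,
    All.++⁺ (All-map (λ (1≤x , x≤N) → 1≤x , m≤n⇒m≤1+n x≤N) c≤N) ((s≤s z≤n , i<1+N) ∷ [])))

-- expect N f = 𝔼[f] · ∏_{t ≤ N} (2t − 1), the scaling used by mass.
expect : ℕ → (List ℕ → ℕ) → ℕ
expect N f = sum (map (λ c → weight c * f c) (outcomes N))

-- (2N + 1) times the expectation of f after one more step, given the first N choices c.
nextSum : ℕ → (List ℕ → ℕ) → List ℕ → ℕ
nextSum N f c = ∑[ i < suc N ] choiceWeight c (suc i) * f (c ∷ʳ suc i)

mass≡expect : ∀ P N → mass P (outcomes N) ≡ expect N (ind ∘ P)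
mass≡expect P N = cong sum (map-cong (λ c → if-then-0≡*-ind (P c) (weight c)) (outcomes N))

expect-cong : ∀ N {f g} → (∀ c → Bounded N c → f c ≡ g c) → expect N f ≡ expect N g
expect-cong N f≡g = sum-map-cong (All-map (λ {c} b → cong (weight c *_) (f≡g c b)) (outcomes-bounded N))

expect-mono-≤ : ∀ N {f g} → (∀ c → Bounded N c → f c ≤ g c) → expect N f ≤ expect N g
expect-mono-≤ N f≤g =
  sum-map-mono-≤ (All-map (λ {c} b → *-monoʳ-≤ (weight c) (f≤g c b)) (outcomes-bounded N))

expect-*ˡ : ∀ N k f → expect N (λ c → k * f c) ≡ k * expect N f
expect-*ˡ N k f =
  trans (cong sum (map-cong (λ c → *-CS.x∙yz≈y∙xz (weight c) k (f c)) (outcomes N)))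
        (sum-map-*ˡ k (λ c → weight c * f c) (outcomes N))

expect-suc : ∀ N f → expect (suc N) f ≡ expect N (nextSum N f)
expect-suc N f =
  trans (sum-map-concatMap F extensions (outcomes N)) (cong sum (map-cong sum-extensions (outcomes N)))
  where
  F : List ℕ → ℕ
  F c = weight c * f c
  extensions : List ℕ → List (List ℕ)
  extensions c = map (c ∷ʳ_) (map suc (upTo (suc N)))
  sum-extensions : ∀ c → sum (map F (extensions c)) ≡ weight c * nextSum N f c
  sum-extensions c = begin
    sum (map F (extensions c))
      ≡⟨ cong (sum ∘ map F) (trans (cong (map (c ∷ʳ_)) (map-applyUpTo id suc (suc N)))
                                   (map-applyUpTo suc (c ∷ʳ_) (suc N))) ⟩
    sum (map F (applyUpTo (λ i → c ∷ʳ suc i) (suc N)))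
      ≡⟨ cong sum (map-applyUpTo (λ i → c ∷ʳ suc i) F (suc N)) ⟩
    sum (applyUpTo (λ i → F (c ∷ʳ suc i)) (suc N))
      ≡⟨ sum-applyUpTo (suc N) (λ i → F (c ∷ʳ suc i)) ⟩
    ∑[ i < suc N ] (weight (c ∷ʳ suc i) * f (c ∷ʳ suc i))
      ≡⟨ ∑-cong (suc N) (λ i _ → trans (cong (_* f (c ∷ʳ suc i)) (weightAux-∷ʳ [] c (suc i)))
                                        (*-assoc (weight c) _ _)) ⟩
    ∑[ i < suc N ] (weight c * (choiceWeight c (suc i) * f (c ∷ʳ suc i)))
      ≡⟨ ∑-*ˡ (suc N) (weight c) (λ i → choiceWeight c (suc i) * f (c ∷ʳ suc i)) ⟩
    weight c * nextSum N f c ∎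
    where open ≡-Reasoning

expect-suc-≤ : ∀ N {f} α β → (∀ c → Bounded N c → β * nextSum N f c ≤ α * f c) →
  β * expect (suc N) f ≤ α * expect N f
expect-suc-≤ N {f} α β step = begin
  β * expect (suc N) f              ≡⟨ cong (β *_) (expect-suc N f) ⟩
  β * expect N (nextSum N f)        ≡⟨ expect-*ˡ N β (nextSum N f) ⟨
  expect N (λ c → β * nextSum N f c) ≤⟨ expect-mono-≤ N step ⟩
  expect N (λ c → α * f c)          ≡⟨ expect-*ˡ N α f ⟩
  α * expect N f                    ∎
  where open ≤-Reasoning

expect-suc-const : ∀ N {f} → (∀ c i → Bounded N c → f (c ∷ʳ i) ≡ f c) →
  expect (suc N) f ≡ suc (N + N) * expect N f
expect-suc-const N {f} ignoresLast = begin
  expect (suc N) f                         ≡⟨ expect-suc N f ⟩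
  expect N (nextSum N f)                   ≡⟨ expect-cong N nextSum≡ ⟩
  expect N (λ c → suc (N + N) * f c)       ≡⟨ expect-*ˡ N (suc (N + N)) f ⟩
  suc (N + N) * expect N f                 ∎
  where
  open ≡-Reasoning
  nextSum≡ : ∀ c → Bounded N c → nextSum N f c ≡ suc (N + N) * f c
  nextSum≡ c b = begin
    ∑[ i < suc N ] choiceWeight c (suc i) * f (c ∷ʳ suc i)
      ≡⟨ ∑-cong (suc N) (λ i _ → trans (cong (choiceWeight c (suc i) *_) (ignoresLast c (suc i) b))
                                        (*-comm (choiceWeight c (suc i)) (f c))) ⟩
    ∑[ i < suc N ] f c * choiceWeight c (suc i)
      ≡⟨ ∑-*ˡ (suc N) (f c) (λ i → choiceWeight c (suc i)) ⟩
    f c * (∑[ i < suc N ] choiceWeight c (suc i))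
      ≡⟨ cong (f c *_) (∑-choiceWeight b) ⟩
    f c * suc (N + N)
      ≡⟨ *-comm (f c) (suc (N + N)) ⟩
    suc (N + N) * f c ∎

any-∷ʳ : ∀ {A : Set} (p : A → Bool) xs x → any p (xs ∷ʳ x) ≡ any p xs ∨ p x
any-∷ʳ p []       x = ∨-identityʳ (p x)
any-∷ʳ p (y ∷ xs) x = trans (cong (p y ∨_) (any-∷ʳ p xs x)) (sym (∨-assoc (p y) _ _))

zip-∷ʳ : ∀ {A B : Set} (xs : List A) (ys : List B) x y → length xs ≡ length ys →
  zip (xs ∷ʳ x) (ys ∷ʳ y) ≡ zip xs ys ∷ʳ (x , y)
zip-∷ʳ []       []       x y _   = refl
zip-∷ʳ (a ∷ xs) (b ∷ ys) x y len = cong ((a , b) ∷_) (zip-∷ʳ xs ys x y (suc-injective len))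

take-∷ʳ : ∀ {A : Set} {n} {xs : List A} x → n ≤ length xs → take n (xs ∷ʳ x) ≡ take n xs
take-∷ʳ {n = zero}              x _         = refl
take-∷ʳ {n = suc n} {y ∷ xs} x (s≤s n≤xs) = cong (y ∷_) (take-∷ʳ x n≤xs)

steps-∷ʳ : ∀ c i → steps (c ∷ʳ i) ≡ steps c ∷ʳ (suc (length c) , i)
steps-∷ʳ c i = begin
  zip (map suc (upTo (length (c ∷ʳ i)))) (c ∷ʳ i)
    ≡⟨ cong (λ n → zip (map suc (upTo n)) (c ∷ʳ i)) (trans (length-++ c) (+-comm (length c) 1)) ⟩
  zip (map suc (upTo (suc (length c)))) (c ∷ʳ i)
    ≡⟨ cong (λ l → zip (map suc l) (c ∷ʳ i)) (sym (upTo-∷ʳ (length c))) ⟩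
  zip (map suc (upTo (length c) ∷ʳ length c)) (c ∷ʳ i)
    ≡⟨ cong (λ l → zip l (c ∷ʳ i)) (map-++ suc (upTo (length c)) [ length c ]) ⟩
  zip (map suc (upTo (length c)) ∷ʳ suc (length c)) (c ∷ʳ i)
    ≡⟨ zip-∷ʳ _ c _ i (trans (length-map suc (upTo (length c))) (length-upTo (length c))) ⟩
  steps c ∷ʳ (suc (length c) , i) ∎
  where open ≡-Reasoning

hasEdgeTo-∷ʳ : ∀ m₁ m₂ σ v W c i → hasEdgeTo m₁ m₂ σ v W (c ∷ʳ i) ≡
  hasEdgeTo m₁ m₂ σ v W c ∨
  ((colourOf m₁ (m₁ + m₂) (suc (length c)) ≟ᶜ σ)
   ∧ joins v W (proj (m₁ + m₂) (suc (length c))) (proj (m₁ + m₂) i))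
hasEdgeTo-∷ʳ m₁ m₂ σ v W c i = trans (cong (any _) (steps-∷ʳ c i)) (any-∷ʳ _ (steps c) _)

/-block : ∀ m u {j} .{{_ : NonZero m}} → j < m → (m * u + j) / m ≡ u
/-block m u {j} j<m = begin
  (m * u + j) / m     ≡⟨ /-congˡ (trans (+-comm (m * u) j) (cong (j +_) (*-comm m u))) ⟩
  (j + u * m) / m     ≡⟨ +-distrib-/-∣ʳ j (n∣m*n u) ⟩
  j / m + u * m / m   ≡⟨ cong₂ _+_ (m<n⇒m/n≡0 j<m) (m*n/n≡m u m) ⟩
  u                   ∎
  where open ≡-Reasoning

%-block : ∀ m u {j} .{{_ : NonZero m}} → j < m → (m * u + j) % m ≡ j
%-block m u {j} j<m = begin
  (m * u + j) % m     ≡⟨ %-congˡ (trans (+-comm (m * u) j) (cong (j +_) (*-comm m u))) ⟩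
  (j + u * m) % m     ≡⟨ [m+kn]%n≡m%n j u m ⟩
  j % m               ≡⟨ m<n⇒m%n≡m j<m ⟩
  j                   ∎
  where open ≡-Reasoning

slotColour : ℕ → ℕ → Colour
slotColour m₁ j = if j <ᵇ m₁ then blue else red

slotColour-< : ∀ {m₁ j} → j < m₁ → slotColour m₁ j ≡ blue
slotColour-< {m₁} {j} j<m₁ with j <ᵇ m₁ | <⇒<ᵇ j<m₁
... | true  | _  = refl
... | false | ()

slotColour-+ : ∀ m₁ i → slotColour m₁ (m₁ + i) ≡ red
slotColour-+ m₁ i with m₁ + i <ᵇ m₁ in lt
... | false = refl
... | true  = ⊥-elim (<⇒≱ (<ᵇ⇒< (m₁ + i) m₁ (subst T (sym lt) tt)) (m≤m+n m₁ i))

proj-block : ∀ m u {j} → j < m → proj m (suc (m * u + j)) ≡ suc u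
proj-block (suc m') u j<m = cong suc (/-block (suc m') u j<m)

colourOf-block : ∀ m₁ m u {j} → j < m → colourOf m₁ m (suc (m * u + j)) ≡ slotColour m₁ j
colourOf-block m₁ (suc m') u j<m = cong (slotColour m₁) (%-block (suc m') u j<m)

∑-slotColour : ∀ m₁ m₂ σ → ∑[ j < m₁ + m₂ ] ind (slotColour m₁ j ≟ᶜ σ) ≡ mOf m₁ m₂ σ
∑-slotColour m₁ m₂ σ = begin
  ∑[ j < m₁ + m₂ ] ind (slotColour m₁ j ≟ᶜ σ)
    ≡⟨ ∑-split m₁ m₂ _ ⟩
  (∑[ j < m₁ ] ind (slotColour m₁ j ≟ᶜ σ)) + (∑[ j < m₂ ] ind (slotColour m₁ (m₁ + j) ≟ᶜ σ))
    ≡⟨ cong₂ _+_ (∑-cong m₁ (λ j j<m₁ → cong (λ c → ind (c ≟ᶜ σ)) (slotColour-< j<m₁)))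
                 (∑-cong m₂ (λ j _ → cong (λ c → ind (c ≟ᶜ σ)) (slotColour-+ m₁ j))) ⟩
  (∑[ _ < m₁ ] ind (blue ≟ᶜ σ)) + (∑[ _ < m₂ ] ind (red ≟ᶜ σ))
    ≡⟨ cong₂ _+_ (∑-const m₁ _) (∑-const m₂ _) ⟩
  m₁ * ind (blue ≟ᶜ σ) + m₂ * ind (red ≟ᶜ σ)
    ≡⟨ by-colour σ ⟩
  mOf m₁ m₂ σ ∎
  where
  open ≡-Reasoning
  by-colour : ∀ σ → m₁ * ind (blue ≟ᶜ σ) + m₂ * ind (red ≟ᶜ σ) ≡ mOf m₁ m₂ σ
  by-colour blue = trans (cong₂ _+_ (*-identityʳ m₁) (*-zeroʳ m₂)) (+-identityʳ m₁)
  by-colour red  = cong₂ _+_ (*-zeroʳ m₁) (*-identityʳ m₂)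

∑-/-blocks : ∀ m u (h : ℕ → ℕ) .{{_ : NonZero m}} → ∑[ i < m * u ] h (i / m) ≡ m * (∑[ q < u ] h q)
∑-/-blocks m zero    h = trans (cong (λ n → ∑[ i < n ] h (i / m)) (*-zeroʳ m)) (sym (*-zeroʳ m))
∑-/-blocks m (suc u) h = begin
  ∑[ i < m * suc u ] h (i / m)
    ≡⟨ cong (λ n → ∑[ i < n ] h (i / m)) (trans (*-suc m u) (+-comm m (m * u))) ⟩
  ∑[ i < m * u + m ] h (i / m)
    ≡⟨ ∑-split (m * u) m _ ⟩
  (∑[ i < m * u ] h (i / m)) + (∑[ j < m ] h ((m * u + j) / m))
    ≡⟨ cong₂ _+_ (∑-/-blocks m u h)
                 (trans (∑-cong m (λ j j<m → cong h (/-block m u j<m))) (∑-const m (h u))) ⟩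
  m * (∑[ q < u ] h q) + m * h u
    ≡⟨ *-distribˡ-+ m _ (h u) ⟨
  m * ((∑[ q < u ] h q) + h u)
    ≡⟨ cong (m *_) (∑-last u h) ⟨
  m * (∑[ q < suc u ] h q) ∎
  where open ≡-Reasoning

∑-ind-memb-proj : ∀ m u W → Unique W → All (λ w → 1 ≤ w × w < suc u) W →
  ∑[ i < m * u ] ind (memb (proj m (suc i)) W) ≡ m * length W
∑-ind-memb-proj zero     u W _  _   = refl
∑-ind-memb-proj (suc m') u W uq rng =
  trans (∑-/-blocks (suc m') u (λ q → ind (memb (suc q) W))) (cong (suc m' *_) (∑-ind-memb u W uq rng))

avoid-bound : ∀ {S B T} v w m → S + B ≡ T → m * w ≤ B → T ≤ m * v + m * v →
  2 * v * S ≤ (2 * v ∸ w) * T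
avoid-bound {S} {B} {T} v w m S+B≡T mw≤B T≤2mv = begin
  2 * v * S              ≡⟨ cong (2 * v *_) (trans (sym (m+n∸n≡m S B)) (cong (_∸ B) S+B≡T)) ⟩
  2 * v * (T ∸ B)        ≡⟨ *-distribˡ-∸ (2 * v) T B ⟩
  2 * v * T ∸ 2 * v * B  ≤⟨ ∸-monoʳ-≤ (2 * v * T) wT≤2vB ⟩
  2 * v * T ∸ w * T      ≡⟨ *-distribʳ-∸ T (2 * v) w ⟨
  (2 * v ∸ w) * T        ∎
  where
  open ≤-Reasoning
  regroup : ∀ w m v → w * (m * v + m * v) ≡ 2 * v * (m * w)
  regroup = solve-∀
  wT≤2vB : w * T ≤ 2 * v * B
  wT≤2vB = begin
    w * T                ≤⟨ *-monoʳ-≤ w T≤2mv ⟩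
    w * (m * v + m * v)  ≡⟨ regroup w m v ⟩
    2 * v * (m * w)      ≤⟨ *-monoʳ-≤ (2 * v) mw≤B ⟩
    2 * v * B            ∎

*-≤-transfer : ∀ P Q α β t {x y x' y'} → P * x ≤ Q * y → α * x' ≤ β * t * x → y' ≡ t * y →
  α * P * x' ≤ β * Q * y'
*-≤-transfer P Q α β t {x} {y} {x'} Px≤Qy αx'≤βtx refl = begin
  α * P * x'        ≡⟨ rearrangeˡ α P x' ⟩
  P * (α * x')      ≤⟨ *-monoʳ-≤ P αx'≤βtx ⟩
  P * (β * t * x)   ≡⟨ rearrangeᵐ P β t x ⟩
  β * t * (P * x)   ≤⟨ *-monoʳ-≤ (β * t) Px≤Qy ⟩
  β * t * (Q * y)   ≡⟨ rearrangeʳ β t Q y ⟩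
  β * Q * (t * y)   ∎
  where
  open ≤-Reasoning
  rearrangeˡ : ∀ α P x' → α * P * x' ≡ P * (α * x')
  rearrangeˡ = solve-∀
  rearrangeᵐ : ∀ P β t x → P * (β * t * x) ≡ β * t * (P * x)
  rearrangeᵐ = solve-∀
  rearrangeʳ : ∀ β t Q y → β * t * (Q * y) ≡ β * Q * (t * y)
  rearrangeʳ = solve-∀

module NoEdgeRatio (m₁ m₂ : ℕ) (σ : Colour) (u : ℕ) (W : List ℕ) (E : List ℕ → Bool)
                   (W-unique : Unique W) (W-below : All (λ w → 1 ≤ w × w < suc u) W) where

  -- E sees only the first a steps, those of the vertices 1, …, v − 1.
  m v a : ℕ
  m = m₁ + m₂
  v = suc u
  a = m * u

  edgeAt : ℕ → ℕ → Bool
  edgeAt t i = (colourOf m₁ m t ≟ᶜ σ) ∧ joins v W (proj m t) (proj m i)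

  prior good : List ℕ → ℕ
  prior c = ind (E (take a c))
  good  c = ind (E (take a c) ∧ not (hasEdgeTo m₁ m₂ σ v W c))

  -- After k steps, s of which added a σ-edge stemming from v.
  Ratio : ℕ → ℕ → Set
  Ratio k s = (2 * v) ^ s * expect k good ≤ (2 * v ∸ length W) ^ s * expect k prior

  prior-∷ʳ : ∀ {k c} i → Bounded k c → a ≤ k → prior (c ∷ʳ i) ≡ prior c
  prior-∷ʳ i (refl , _) a≤k = cong (ind ∘ E) (take-∷ʳ i a≤k)

  good-∷ʳ : ∀ {k c} i → Bounded k c → a ≤ k → good (c ∷ʳ i) ≡ good c * ind (not (edgeAt (suc k) i))
  good-∷ʳ {c = c} i (refl , _) a≤k =
    trans (cong₂ (λ p h → ind (E p ∧ not h)) (take-∷ʳ i a≤k) (hasEdgeTo-∷ʳ m₁ m₂ σ v W c i))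
          (ind-∧-not-∨ (E (take a c)) (hasEdgeTo m₁ m₂ σ v W c) (edgeAt (suc (length c)) i))

  avoiding : ℕ → List ℕ → ℕ
  avoiding k c = ∑[ i < suc k ] choiceWeight c (suc i) * ind (not (edgeAt (suc k) (suc i)))

  nextSum-good : ∀ {k c} → Bounded k c → a ≤ k → nextSum k good c ≡ good c * avoiding k c
  nextSum-good {k} {c} b a≤k =
    trans (∑-cong (suc k) (λ i _ → trans (cong (choiceWeight c (suc i) *_) (good-∷ʳ (suc i) b a≤k))
                                          (*-CS.x∙yz≈y∙xz (choiceWeight c (suc i)) (good c) _)))
          (∑-*ˡ (suc k) (good c) (λ i → choiceWeight c (suc i) * ind (not (edgeAt (suc k) (suc i)))))

  avoiding-≤ : ∀ {k c} → Bounded k c → avoiding k c ≤ suc (k + k)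
  avoiding-≤ {k} {c} b = begin
    avoiding k c
      ≤⟨ ∑-mono-≤ (suc k) (λ i _ → *-≤-ind≤1 (choiceWeight c (suc i)) (not (edgeAt (suc k) (suc i)))) ⟩
    ∑[ i < suc k ] choiceWeight c (suc i)
      ≡⟨ ∑-choiceWeight b ⟩
    suc (k + k) ∎
    where
    open ≤-Reasoning
    *-≤-ind≤1 : ∀ w b → w * ind b ≤ w
    *-≤-ind≤1 w b = ≤-trans (*-monoʳ-≤ w (ind≤1 b)) (≤-reflexive (*-identityʳ w))

  Ratio-suc : ∀ {k s} → a ≤ k → Ratio k s → Ratio (suc k) s
  Ratio-suc {k} {s} a≤k ratio =
    subst₂ (λ x y → x * expect (suc k) good ≤ y * expect (suc k) prior)
           (*-identityˡ ((2 * v) ^ s)) (*-identityˡ ((2 * v ∸ length W) ^ s))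
           (*-≤-transfer ((2 * v) ^ s) ((2 * v ∸ length W) ^ s) 1 1 (suc (k + k)) ratio good-step
                         (expect-suc-const k (λ c i b → prior-∷ʳ i b a≤k)))
    where
    good-step : 1 * expect (suc k) good ≤ 1 * suc (k + k) * expect k good
    good-step = subst (λ T → 1 * expect (suc k) good ≤ T * expect k good) (sym (*-identityˡ (suc (k + k))))
      (expect-suc-≤ k (suc (k + k)) 1 λ c b → begin
        1 * nextSum k good c    ≡⟨ *-identityˡ _ ⟩
        nextSum k good c        ≡⟨ nextSum-good b a≤k ⟩
        good c * avoiding k c   ≤⟨ *-monoʳ-≤ (good c) (avoiding-≤ b) ⟩
        good c * suc (k + k)    ≡⟨ *-comm (good c) _ ⟩
        suc (k + k) * good c    ∎)
      where open ≤-Reasoning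

  memb-v≡false : memb v W ≡ false
  memb-v≡false = memb-false W (All-map (λ (_ , w<v) v≡w → <⇒≢ w<v (sym v≡w)) W-below)

  edgeAt-slot : ∀ {j} → j < m → (slotColour m₁ j ≟ᶜ σ) ≡ true →
    ∀ x → edgeAt (suc (a + j)) x ≡ memb (proj m x) W
  edgeAt-slot {j} j<m col x
    rewrite colourOf-block m₁ m u j<m | col | proj-block m u j<m | ≡ᵇ-refl v | memb-v≡false
          | ∧-zeroʳ (proj m x ≡ᵇ v) = ∨-identityʳ _

  avoiding-slot : ∀ {j c} → j < m → (slotColour m₁ j ≟ᶜ σ) ≡ true → Bounded (a + j) c →
    2 * v * avoiding (a + j) c ≤ (2 * v ∸ length W) * suc (a + j + (a + j))
  avoiding-slot {j} {c} j<m col b = avoid-bound v (length W) m S+B≡T mW≤B T≤2mv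
    where
    k : ℕ
    k = a + j
    cw inW outW : ℕ → ℕ
    cw   i = choiceWeight c (suc i)
    inW  i = ind (memb (proj m (suc i)) W)
    outW i = ind (not (memb (proj m (suc i)) W))
    B : ℕ
    B = ∑[ i < suc k ] cw i * inW i
    S+B≡T : avoiding k c + B ≡ suc (k + k)
    S+B≡T = begin
      avoiding k c + B
        ≡⟨ cong (_+ B) (∑-cong (suc k) λ i _ →
             cong (λ e → choiceWeight c (suc i) * ind (not e)) (edgeAt-slot j<m col (suc i))) ⟩
      (∑[ i < suc k ] cw i * outW i) + B
        ≡⟨ ∑-distrib-+ (suc k) (λ i → cw i * outW i) (λ i → cw i * inW i) ⟨
      ∑[ i < suc k ] (cw i * outW i + cw i * inW i)
        ≡⟨ ∑-cong (suc k) (λ i _ → *-ind-not+*-ind (cw i) (memb (proj m (suc i)) W)) ⟩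
      ∑[ i < suc k ] cw i
        ≡⟨ ∑-choiceWeight b ⟩
      suc (k + k) ∎
      where open ≡-Reasoning
    mW≤B : m * length W ≤ B
    mW≤B = begin
      m * length W               ≡⟨ ∑-ind-memb-proj m u W W-unique W-below ⟨
      ∑[ i < a ] inW i           ≤⟨ ∑-prefix-≤ inW (m≤n⇒m≤1+n (m≤m+n a j)) ⟩
      ∑[ i < suc k ] inW i       ≤⟨ ∑-mono-≤ (suc k) (λ i i≤k →
                                      ind≤*-ind (cw i) (memb (proj m (suc i)) W) (choiceWeight-pos b i≤k)) ⟩
      B                          ∎
      where open ≤-Reasoning
    1+k≤mv : suc k ≤ m * v
    1+k≤mv = begin
      suc (a + j)  ≡⟨ +-suc a j ⟨
      a + suc j    ≤⟨ +-monoʳ-≤ a j<m ⟩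
      a + m        ≡⟨ +-comm a m ⟩
      m + a        ≡⟨ *-suc m u ⟨
      m * v        ∎
      where open ≤-Reasoning
    T≤2mv : suc (k + k) ≤ m * v + m * v
    T≤2mv = +-mono-≤ 1+k≤mv (≤-trans (n≤1+n k) 1+k≤mv)

  Ratio-suc-slot : ∀ {j s} → j < m → (slotColour m₁ j ≟ᶜ σ) ≡ true →
    Ratio (a + j) s → Ratio (suc (a + j)) (suc s)
  Ratio-suc-slot {j} {s} j<m col ratio =
    *-≤-transfer ((2 * v) ^ s) ((2 * v ∸ length W) ^ s) (2 * v) (2 * v ∸ length W) (suc (k + k))
                 ratio good-step (expect-suc-const k (λ c i b → prior-∷ʳ i b a≤k))
    where
    open ≤-Reasoning
    k : ℕ
    k = a + j
    a≤k : a ≤ k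
    a≤k = m≤m+n a j
    good-step : 2 * v * expect (suc k) good ≤ (2 * v ∸ length W) * suc (k + k) * expect k good
    good-step = expect-suc-≤ k ((2 * v ∸ length W) * suc (k + k)) (2 * v) λ c b → begin
      2 * v * nextSum k good c         ≡⟨ cong (2 * v *_) (nextSum-good b a≤k) ⟩
      2 * v * (good c * avoiding k c)  ≡⟨ *-CS.x∙yz≈y∙xz (2 * v) (good c) _ ⟩
      good c * (2 * v * avoiding k c)  ≤⟨ *-monoʳ-≤ (good c) (avoiding-slot j<m col b) ⟩
      good c * ((2 * v ∸ length W) * suc (k + k)) ≡⟨ *-comm (good c) _ ⟩
      (2 * v ∸ length W) * suc (k + k) * good c   ∎

  slotCount : ℕ → ℕ
  slotCount j = ∑[ i < j ] ind (slotColour m₁ i ≟ᶜ σ)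

  Ratio-slot-step : ∀ {s} j → j < m →
    Ratio (a + j) s → Ratio (suc (a + j)) (s + ind (slotColour m₁ j ≟ᶜ σ))
  Ratio-slot-step {s} j j<m ratio with slotColour m₁ j ≟ᶜ σ in col
  ... | true  = subst (Ratio (suc (a + j))) (+-comm 1 s) (Ratio-suc-slot {j} {s} j<m col ratio)
  ... | false = subst (Ratio (suc (a + j))) (sym (+-identityʳ s)) (Ratio-suc {a + j} {s} (m≤m+n a j) ratio)

  Ratio-start : Ratio a 0
  Ratio-start = *-monoʳ-≤ 1 (expect-mono-≤ a λ c _ → ind-∧-≤ (E (take a c)) (not (hasEdgeTo m₁ m₂ σ v W c)))

  Ratio-slots : ∀ j → j ≤ m → Ratio (a + j) (slotCount j)
  Ratio-slots zero    _     = subst (λ k → Ratio k 0) (sym (+-identityʳ a)) Ratio-start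
  Ratio-slots (suc j) 1+j≤m =
    subst₂ Ratio (sym (+-suc a j)) (sym (∑-last j (λ i → ind (slotColour m₁ i ≟ᶜ σ))))
           (Ratio-slot-step {slotCount j} j 1+j≤m (Ratio-slots j (≤-trans (n≤1+n j) 1+j≤m)))

  Ratio-later : ∀ {k s} d → a ≤ k → Ratio k s → Ratio (k + d) s
  Ratio-later {k} {s} zero    _   ratio = subst (λ k → Ratio k s) (sym (+-identityʳ k)) ratio
  Ratio-later {k} {s} (suc d) a≤k ratio =
    subst (λ k → Ratio k s) (sym (+-suc k d))
          (Ratio-suc {k + d} {s} (≤-trans a≤k (m≤m+n k d)) (Ratio-later {k} {s} d a≤k ratio))

  Ratio-final : ∀ d → Ratio (m * (v + d)) (mOf m₁ m₂ σ)
  Ratio-final d =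
    subst₂ Ratio (trans (cong (_+ m * d) a+m≡m*v) (sym (*-distribˡ-+ m v d))) (∑-slotColour m₁ m₂ σ)
           (Ratio-later {a + m} {slotCount m} (m * d) (m≤m+n a m) (Ratio-slots m ≤-refl))
    where
    a+m≡m*v : a + m ≡ m * v
    a+m≡m*v = trans (+-comm a m) (sym (*-suc m u))

lemma3 : (m₁ m₂ n : ℕ) (σ : Colour) (v : ℕ) → 1 ≤ v → v ≤ n →
         (W : List ℕ) → Unique W → All (λ w → 1 ≤ w × w < v) W →
         (E : List ℕ → Bool) →
         (2 * v) ^ mOf m₁ m₂ σ
           * mass (λ cs → E (take ((m₁ + m₂) * (v ∸ 1)) cs)
                          ∧ not (hasEdgeTo m₁ m₂ σ v W cs))
                  (outcomes ((m₁ + m₂) * n))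
         ≤ (2 * v ∸ length W) ^ mOf m₁ m₂ σ
           * mass (λ cs → E (take ((m₁ + m₂) * (v ∸ 1)) cs))
                  (outcomes ((m₁ + m₂) * n))
lemma3 m₁ m₂ n σ (suc u) (s≤s z≤n) v≤n W W-unique W-below E with m≤n⇒∃[o]m+o≡n v≤n
... | d , refl =
  subst₂ (λ x y → (2 * v) ^ mOf m₁ m₂ σ * x ≤ (2 * v ∸ length W) ^ mOf m₁ m₂ σ * y)
         (sym (mass≡expect _ (m * (v + d)))) (sym (mass≡expect _ (m * (v + d))))
         (Ratio-final d)
  where open NoEdgeRatio m₁ m₂ σ u W E W-unique W-below
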